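{- Let $k\ge 3$, let $G$ be a $k$-uniform hypergraph, let $\Pi=(P,\psi_\Pi)$ be a picture over $G$ with $P\subseteq[k]^m$, let $x\in V(G)$ with music line $\Pi_x=\psi_\Pi^{ -1}(x)$, let $n\ge1$ and let $\mathscr{L}$ be a collection of combinatorial lines in $\Pi_x^n$. Then: (i) for every $U\in \mathscr{L}$ the pair $\Pi^U=(P^U, \psi_U)$ is a picture over $G$ with $\psi_U^{ -1}(x)=U$; (ii) if $U, V\in \mathscr{L}$ are distinct, then $P^U\cap P^V=U\cap V$.
   Context: Combinatorial lines and quasilines in $[k]^N$: a combinatorial line is the image of a map $\eta\colon[k]\to[k]^N$ for which there is a partition $[N]=C\cup M$, $M\ne\emptyset$, with the points of the image agreeing on each coordinate in $C$ and the $i$-th point having entry $i$ in every coordinate of $M$; a quasiline is a $k$-element subset such that in every coordinate its points have either all identical or mutually distinct entries. A picture over a $k$-uniform hypergraph $G$ ($k\ge3$) is a pair $(P,\psi)$ with $P\subseteq[k]^m$ for some $m$ and $\psi\colon P\to V(G)$ such that every quasiline $L\subseteq P$ is a combinatorial line with $\psi[L]\in E(G)$. For any finite set $A$, a combinatorial line $U$ in $A^n$ is the image of a map $\eta_U\colon A\to A^n$ given by a partition $[n]=C\cup M$ with $M\ne\emptyset$ and a function $g\colon C\to A$, where the $j$-th coordinate of $\eta_U(a)$ is $g(j)$ for $j\in C$ and $a$ for $j\in M$. Here $A=\Pi_x\subseteq[k]^m$; for each $U\in\mathscr{L}$, with data $(C,M,g)$, define $\eta_U^+\colon[k]^m\to([k]^m)^n\cong[k]^{mn}$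 by the same rule: the $j$-th block of $\eta_U^+(a)$ is $g(j)$ if $j\in C$ and $a$ if $j\in M$ (for $a\in[k]^m$). Set $P^U=\eta_U^+[P]\subseteq[k]^{mn}$ and $\psi_U=\psi_\Pi\circ(\eta_U^+|_P)^{ -1}\colon P^U\to V(G)$. -}

module Defs where

open import Data.Nat using (ℕ; _*_)
open import Data.Fin using (Fin)
open import Data.Vec using (Vec; lookup; map; concat)
open import Data.Maybe using (Maybe; just; nothing; fromMaybe)
open import Data.Product using (Σ; ∃; _×_; _,_)
open import Data.Sum using (_⊎_)
open import Function.Definitions using (Injective)
open import Function.Bundles using (_⇔_)
open import Relation.Binary.PropositionalEquality using (_≡_)

Point : ℕ → ℕ → Set
Point k N = Vec (Fin k) N

-- Each edge is given by an enumeration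
-- e : Fin k → V (necessarily injective, so the edge has exactly k elements);
-- the edge set E(G) is the set of images of the tuples e with E e.
record Hypergraph (k : ℕ) : Set₁ where
  field
    V     : Set
    E     : (Fin k → V) → Set
    E-inj : ∀ {e} → E e → Injective _≡_ _≡_ e
open Hypergraph public

_∈img_ : {A B : Set} → B → (A → B) → Set
b ∈img f = ∃ λ a → f a ≡ b

-- Combinatorial line data in A^N: a word w over A ∪ {*} (nothing = moving
-- coordinate in M, just c = constant coordinate in C with g(j) = c),
-- having at least one moving coordinate.
record LineData (A : Set) (N : ℕ) : Set where
  constructor lineData
  field
    word : Vec (Maybe A) N
    free : ∃ λ j → lookup word j ≡ nothing
open LineData public

η : {A : Set} {N : ℕ} → Vec (Maybe A) N → A → Vec A N
η w a = map (fromMaybe a) w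

IsCombLine : {k N : ℕ} → (Fin k → Point k N) → Set
IsCombLine {k} {N} ℓ =
  Σ (LineData (Fin k) N) λ d → ∀ p → (p ∈img ℓ) ⇔ (p ∈img η (word d))

IsQuasiline : {k N : ℕ} → (Fin k → Point k N) → Set
IsQuasiline {k} {N} ℓ =
  Injective _≡_ _≡_ ℓ ×
  (∀ (i : Fin N) →
     (∀ s t → lookup (ℓ s) i ≡ lookup (ℓ t) i) ⊎
     Injective _≡_ _≡_ (λ t → lookup (ℓ t) i))

-- A picture (P, ψ) with P ⊆ [k]^N is given as the graph Ψ of the partial
-- map ψ : [k]^N ⇀ V(G):  Ψ a v  means  a ∈ P and ψ(a) = v.
Dom : {k N : ℕ} {V : Set} → (Point k N → V → Set) → Point k N → Set
Dom Ψ a = ∃ λ v → Ψ a v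

Functional : {k N : ℕ} {V : Set} → (Point k N → V → Set) → Set
Functional Ψ = ∀ a v v′ → Ψ a v → Ψ a v′ → v ≡ v′

ImageIsEdge : {k N : ℕ} (G : Hypergraph k) →
              (Point k N → V G → Set) → (Fin k → Point k N) → Set
ImageIsEdge {k} G Ψ ℓ =
  Σ (Fin k → V G) λ e → E G e × (∀ v → (∃ λ t → Ψ (ℓ t) v) ⇔ (v ∈img e))

IsPicture : {k N : ℕ} (G : Hypergraph k) → (Point k N → V G → Set) → Set
IsPicture G Ψ =
  Functional Ψ ×
  (∀ ℓ → IsQuasiline ℓ → (∀ t → Dom Ψ (ℓ t)) →
     IsCombLine ℓ × ImageIsEdge G Ψ ℓ)

-- Combinatorial lines in Π_x^n, where Π_x = ψ⁻¹(x) ⊆ [k]^m: line data over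
-- [k]^m whose constant values lie in Π_x.
record LineInMusic {k m : ℕ} {V : Set} (Ψ : Point k m → V → Set) (x : V)
                   (n : ℕ) : Set where
  field
    line   : LineData (Point k m) n
    consts : ∀ j c → lookup (word line) j ≡ just c → Ψ c x
open LineInMusic public

-- η_U^+ : [k]^m → ([k]^m)^n ≅ [k]^{n*m}  (identification by concatenation)
η⁺ : {k m n : ℕ} → Vec (Maybe (Point k m)) n → Point k m → Point k (n * m)
η⁺ w a = concat (η w a)

module _ {k m : ℕ} {V : Set} {Ψ : Point k m → V → Set} {x : V} {n : ℕ} where

  Ψ^ : LineInMusic Ψ x n → Point k (n * m) → V → Set
  Ψ^ U z v = ∃ λ a → η⁺ (word (line U)) a ≡ z × Ψ a v

  P^ : LineInMusic Ψ x n → Point k (n * m) → Set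
  P^ U z = ∃ λ a → Dom Ψ a × η⁺ (word (line U)) a ≡ z

  _∈L_ : Point k (n * m) → LineInMusic Ψ x n → Set
  z ∈L U = ∃ λ a → Ψ a x × concat (η (word (line U)) a) ≡ z

{-# OPTIONS --safe #-}
module Submission where

-- A picture Π over G can be blown up along a combinatorial line U of Π_x^n: the map η_U^+ is
-- injective (U has a moving block) and reads a point back off any moving block, so a
-- quasiline in η_U^+[P] is η_U^+ of a quasiline in P, which is a combinatorial line of Π;
-- substituting that line into the moving blocks of U gives a combinatorial line of
-- [k]^{nm} with the same ψ-image.  For two distinct lines U, W through η_U^+(a) = η_W^+(b),
-- the moving blocks of U show that a is either a constant of W, hence in Π_x, or equal to
-- b; and if a = b, the two words differ in a block where one is the constant a.

open import Defs
open import Data.Nat using (ℕ; _≤_; _*_)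
open import Data.Fin using (Fin; zero; suc; combine)
open import Data.Vec using (Vec; []; _∷_; lookup; map; concat)
open import Data.Vec.Properties
  using (lookup-map; lookup-concat; map-concat; map-∘; map-cong; map-id;
         ++-injectiveˡ; ++-injectiveʳ; ∷-injective)
open import Data.Maybe using (Maybe; just; nothing; fromMaybe)
open import Data.Product using (∃; _×_; _,_; proj₁; proj₂)
open import Data.Sum using (_⊎_; inj₁; inj₂)
open import Data.Empty using (⊥-elim)
open import Function using (_∘_)
open import Function.Bundles using (_⇔_; mk⇔; Equivalence)
open import Relation.Binary.PropositionalEquality
  using (_≡_; _≢_; _≗_; refl; sym; trans; cong; cong₂; subst; module ≡-Reasoning)

open Equivalence

private
  variable
    A : Set
    k m n N : ℕ

concat-injective : (xss yss : Vec (Vec A m) n) → concat xss ≡ concat yss → xss ≡ yss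
concat-injective []         []         _  = refl
concat-injective (xs ∷ xss) (ys ∷ yss) eq =
  cong₂ _∷_ (++-injectiveˡ xs ys eq) (concat-injective xss yss (++-injectiveʳ xs ys eq))

lookup-η : (w : Vec (Maybe A) n) (a : A) (j : Fin n) →
           lookup (η w a) j ≡ fromMaybe a (lookup w j)
lookup-η w a j = lookup-map j (fromMaybe a) w

lookup-η-moving : (w : Vec (Maybe A) n) (a : A) {j : Fin n} → lookup w j ≡ nothing →
                  lookup (η w a) j ≡ a
lookup-η-moving w a {j} w[j]≡* = trans (lookup-η w a j) (cong (fromMaybe a) w[j]≡*)

η-injective : (L : LineData A n) {a b : A} → η (word L) a ≡ η (word L) b → a ≡ b
η-injective L {a} {b} eq = begin
  a                         ≡⟨ sym (lookup-η-moving (word L) a j*) ⟩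
  lookup (η (word L) a) j   ≡⟨ cong (λ p → lookup p j) eq ⟩
  lookup (η (word L) b) j   ≡⟨ lookup-η-moving (word L) b j* ⟩
  b                         ∎
  where
  open ≡-Reasoning
  j = proj₁ (free L)
  j* = proj₂ (free L)

η⁺-injective : (L : LineData (Point k m) n) {a b : Point k m} →
               η⁺ (word L) a ≡ η⁺ (word L) b → a ≡ b
η⁺-injective L eq = η-injective L (concat-injective _ _ eq)

lookup-η⁺-moving : (w : Vec (Maybe (Point k m)) n) (a : Point k m) {j : Fin n} →
                   lookup w j ≡ nothing → ∀ i → lookup (η⁺ w a) (combine j i) ≡ lookup a i
lookup-η⁺-moving w a {j} w[j]≡* i =
  trans (lookup-concat (η w a) j i) (cong (λ p → lookup p i) (lookup-η-moving w a w[j]≡*))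

module _ (f : Point k m → Point k N) (π : Fin m → Fin N)
         (f-reads : ∀ a i → lookup (f a) (π i) ≡ lookup a i) where

  quasiline-reflect : (α : Fin k → Point k m) (ℓ : Fin k → Point k N) → f ∘ α ≗ ℓ →
                      IsQuasiline ℓ → IsQuasiline α
  quasiline-reflect α ℓ fα≗ℓ (ℓ-injective , ℓ-coords) = α-injective , α-coords
    where
    α≡ℓ : ∀ t i → lookup (α t) i ≡ lookup (ℓ t) (π i)
    α≡ℓ t i = trans (sym (f-reads (α t) i)) (cong (λ p → lookup p (π i)) (fα≗ℓ t))

    α-injective : ∀ {s t} → α s ≡ α t → s ≡ t
    α-injective {s} {t} eq = ℓ-injective (trans (sym (fα≗ℓ s)) (trans (cong f eq) (fα≗ℓ t)))

    α-coords : ∀ i → (∀ s t → lookup (α s) i ≡ lookup (α t) i) ⊎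
                     (∀ {s t} → lookup (α s) i ≡ lookup (α t) i → s ≡ t)
    α-coords i with ℓ-coords (π i)
    ... | inj₁ constant =
      inj₁ λ s t → trans (α≡ℓ s i) (trans (constant s t) (sym (α≡ℓ t i)))
    ... | inj₂ distinct =
      inj₂ λ {s} {t} eq → distinct (trans (sym (α≡ℓ s i)) (trans eq (α≡ℓ t i)))

-- The word of the line η_U^+ ∘ η_d: constant blocks of U stay constant, moving ones become d.
substituteBlock : Vec (Maybe (Fin k)) m → Maybe (Point k m) → Vec (Maybe (Fin k)) m
substituteBlock d (just c) = map just c
substituteBlock d nothing  = d

composeWord : Vec (Maybe (Point k m)) n → Vec (Maybe (Fin k)) m → Vec (Maybe (Fin k)) (n * m)
composeWord w d = concat (map (substituteBlock d) w)

η-substituteBlock : (d : Vec (Maybe (Fin k)) m) (s : Fin k) (b : Maybe (Point k m)) →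
                    η (substituteBlock d b) s ≡ fromMaybe (η d s) b
η-substituteBlock d s (just c) = trans (sym (map-∘ (fromMaybe s) just c)) (map-id c)
η-substituteBlock d s nothing  = refl

η-composeWord : (w : Vec (Maybe (Point k m)) n) (d : Vec (Maybe (Fin k)) m) (s : Fin k) →
                η (composeWord w d) s ≡ η⁺ w (η d s)
η-composeWord w d s = begin
  map (fromMaybe s) (concat (map (substituteBlock d) w))
    ≡⟨ map-concat (fromMaybe s) (map (substituteBlock d) w) ⟩
  concat (map (map (fromMaybe s)) (map (substituteBlock d) w))
    ≡⟨ cong concat (sym (map-∘ _ _ w)) ⟩
  concat (map (λ b → η (substituteBlock d b) s) w)
    ≡⟨ cong concat (map-cong (η-substituteBlock d s) w) ⟩
  concat (map (fromMaybe (η d s)) w)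
    ∎
  where open ≡-Reasoning

lookup-composeWord-moving : (w : Vec (Maybe (Point k m)) n) (d : Vec (Maybe (Fin k)) m)
                            {j : Fin n} {i : Fin m} →
                            lookup w j ≡ nothing → lookup d i ≡ nothing →
                            lookup (composeWord w d) (combine j i) ≡ nothing
lookup-composeWord-moving w d {j} {i} w[j]≡* d[i]≡* = begin
  lookup (composeWord w d) (combine j i)
    ≡⟨ lookup-concat (map (substituteBlock d) w) j i ⟩
  lookup (lookup (map (substituteBlock d) w) j) i
    ≡⟨ cong (λ b → lookup b i) (lookup-map j _ w) ⟩
  lookup (substituteBlock d (lookup w j)) i
    ≡⟨ cong (λ b → lookup (substituteBlock d b) i) w[j]≡* ⟩
  lookup d i
    ≡⟨ d[i]≡* ⟩
  nothing
    ∎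
  where open ≡-Reasoning

combLine-η⁺ : (L : LineData (Point k m) n) (α : Fin k → Point k m)
              (ℓ : Fin k → Point k (n * m)) →
              η⁺ (word L) ∘ α ≗ ℓ → IsCombLine α → IsCombLine ℓ
combLine-η⁺ L α ℓ ηα≗ℓ (d , α≈d) =
  lineData (composeWord w (word d))
           (combine j i , lookup-composeWord-moving w (word d) w[j]≡* d[i]≡*) ,
  λ p → mk⇔ (ℓ⇒composed p) (composed⇒ℓ p)
  where
  w = word L
  j = proj₁ (free L)
  w[j]≡* = proj₂ (free L)
  i = proj₁ (free d)
  d[i]≡* = proj₂ (free d)

  ℓ⇒composed : ∀ p → p ∈img ℓ → p ∈img η (composeWord w (word d))
  ℓ⇒composed p (t , ℓt≡p) with to (α≈d (α t)) (t , refl)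
  ... | s , ηds≡αt =
    s , trans (η-composeWord w (word d) s) (trans (cong (η⁺ w) ηds≡αt) (trans (ηα≗ℓ t) ℓt≡p))

  composed⇒ℓ : ∀ p → p ∈img η (composeWord w (word d)) → p ∈img ℓ
  composed⇒ℓ p (s , ηs≡p) with from (α≈d (η (word d) s)) (s , refl)
  ... | t , αt≡ηds =
    t , trans (sym (ηα≗ℓ t))
              (trans (cong (η⁺ w) αt≡ηds) (trans (sym (η-composeWord w (word d) s)) ηs≡p))

module _ {G : Hypergraph k} {Ψ : Point k m → V G → Set} {x : V G}
         (U : LineInMusic Ψ x n) where

  private
    w = word (line U)

  Ψ^-functional : Functional Ψ → Functional (Ψ^ U)
  Ψ^-functional Ψ-functional z v v′ (a , ηa≡z , Ψav) (b , ηb≡z , Ψbv′) =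
    Ψ-functional a v v′ Ψav (subst (λ c → Ψ c v′) (sym a≡b) Ψbv′)
    where
    a≡b : a ≡ b
    a≡b = η⁺-injective (line U) (trans ηa≡z (sym ηb≡z))

  imageIsEdge-η⁺ : (α : Fin k → Point k m) (ℓ : Fin k → Point k (n * m)) → η⁺ w ∘ α ≗ ℓ →
                   ImageIsEdge G Ψ α → ImageIsEdge G (Ψ^ U) ℓ
  imageIsEdge-η⁺ α ℓ ηα≗ℓ (e , e∈E , α≈e) = e , e∈E , λ v → mk⇔ (ℓ⇒e v) (e⇒ℓ v)
    where
    ℓ⇒e : ∀ v → (∃ λ t → Ψ^ U (ℓ t) v) → v ∈img e
    ℓ⇒e v (t , a , ηa≡ℓt , Ψav) =
      to (α≈e v) (t , subst (λ c → Ψ c v) a≡αt Ψav)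
      where
      a≡αt : a ≡ α t
      a≡αt = η⁺-injective (line U) (trans ηa≡ℓt (sym (ηα≗ℓ t)))

    e⇒ℓ : ∀ v → v ∈img e → ∃ λ t → Ψ^ U (ℓ t) v
    e⇒ℓ v v∈e with from (α≈e v) v∈e
    ... | t , Ψαtv = t , α t , ηα≗ℓ t , Ψαtv

  Ψ^-isPicture : IsPicture G Ψ → IsPicture G (Ψ^ U)
  Ψ^-isPicture (Ψ-functional , Ψ-lines) = Ψ^-functional Ψ-functional , Ψ^-lines
    where
    Ψ^-lines : ∀ ℓ → IsQuasiline ℓ → (∀ t → Dom (Ψ^ U) (ℓ t)) →
               IsCombLine ℓ × ImageIsEdge G (Ψ^ U) ℓ
    Ψ^-lines ℓ ℓ-quasiline ℓ⊆P^U =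
      combLine-η⁺ (line U) α ℓ ηα≗ℓ α-line , imageIsEdge-η⁺ α ℓ ηα≗ℓ α-edge
      where
      α : Fin k → Point k m
      α t = proj₁ (proj₂ (ℓ⊆P^U t))

      ηα≗ℓ : η⁺ w ∘ α ≗ ℓ
      ηα≗ℓ t = proj₁ (proj₂ (proj₂ (ℓ⊆P^U t)))

      α⊆P : ∀ t → Dom Ψ (α t)
      α⊆P t = proj₁ (ℓ⊆P^U t) , proj₂ (proj₂ (proj₂ (ℓ⊆P^U t)))

      α-quasiline : IsQuasiline α
      α-quasiline = quasiline-reflect (η⁺ w) (combine (proj₁ (free (line U))))
                      (λ a → lookup-η⁺-moving w a (proj₂ (free (line U)))) α ℓ ηα≗ℓ ℓ-quasiline

      α-line : IsCombLine α
      α-line = proj₁ (Ψ-lines α α-quasiline α⊆P)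

      α-edge : ImageIsEdge G Ψ α
      α-edge = proj₂ (Ψ-lines α α-quasiline α⊆P)

  Ψ^-fibre : ∀ z → Ψ^ U z x ⇔ z ∈L U
  Ψ^-fibre z = mk⇔ (λ (a , ηa≡z , Ψax) → a , Ψax , ηa≡z)
                   (λ (a , Ψax , ηa≡z) → a , ηa≡z , Ψax)

ConstantsIn : (A → Set) → Vec (Maybe A) n → Set
ConstantsIn S w = ∀ j c → lookup w j ≡ just c → S c

module _ {S : A → Set} where

  fromMaybe-constant : {o : Maybe A} {a b : A} → (∀ c → o ≡ just c → S c) →
                       a ≡ fromMaybe b o → S a ⊎ a ≡ b
  fromMaybe-constant {o = nothing} _   a≡b = inj₂ a≡b
  fromMaybe-constant {o = just c}  S-o a≡c = inj₁ (subst S (sym a≡c) (S-o c refl))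

  fromMaybe-agree : (o o′ : Maybe A) {a : A} →
                    (∀ c → o ≡ just c → S c) → (∀ c → o′ ≡ just c → S c) →
                    fromMaybe a o ≡ fromMaybe a o′ → S a ⊎ o ≡ o′
  fromMaybe-agree nothing  nothing  _   _    _   = inj₂ refl
  fromMaybe-agree (just c) (just _) _   _    c≡c′ = inj₂ (cong just c≡c′)
  fromMaybe-agree (just c) nothing  S-o _    c≡a = inj₁ (subst S c≡a (S-o c refl))
  fromMaybe-agree nothing  (just c) _   S-o′ a≡c = inj₁ (subst S (sym a≡c) (S-o′ c refl))

  η-agree : (u w : Vec (Maybe A) n) {a : A} → ConstantsIn S u → ConstantsIn S w →
            η u a ≡ η w a → S a ⊎ u ≡ w
  η-agree []      []       _   _   _  = inj₂ refl
  η-agree (o ∷ u) (o′ ∷ w) S-ou S-o′w eq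
    with ∷-injective eq
  ... | heads , tails
    with fromMaybe-agree o o′ (S-ou zero) (S-o′w zero) heads
       | η-agree u w (S-ou ∘ suc) (S-o′w ∘ suc) tails
  ... | inj₁ Sa  | _        = inj₁ Sa
  ... | inj₂ _   | inj₁ Sa  = inj₁ Sa
  ... | inj₂ o≡o′ | inj₂ u≡w = inj₂ (cong₂ _∷_ o≡o′ u≡w)

  η-meet-left : (u w : LineData A n) {a b : A} →
                ConstantsIn S (word u) → ConstantsIn S (word w) →
                word u ≢ word w → η (word u) a ≡ η (word w) b → S a
  η-meet-left u w {a} {b} S-u S-w u≢w eq
    with fromMaybe-constant (S-w j) a≡w[j]
    where
    j = proj₁ (free u)
    a≡w[j] : a ≡ fromMaybe b (lookup (word w) j)
    a≡w[j] = trans (sym (lookup-η-moving (word u) a (proj₂ (free u))))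
                   (trans (cong (λ p → lookup p j) eq) (lookup-η (word w) b j))
  ... | inj₁ Sa = Sa
  ... | inj₂ refl with η-agree (word u) (word w) S-u S-w eq
  ...   | inj₁ Sa  = Sa
  ...   | inj₂ u≡w = ⊥-elim (u≢w u≡w)

  η-meet : (u w : LineData A n) {a b : A} →
           ConstantsIn S (word u) → ConstantsIn S (word w) →
           word u ≢ word w → η (word u) a ≡ η (word w) b → S a × S b
  η-meet u w S-u S-w u≢w eq =
    η-meet-left u w S-u S-w u≢w eq , η-meet-left w u S-w S-u (u≢w ∘ sym) (sym eq)

P^-meet : {G : Hypergraph k} {Ψ : Point k m → V G → Set} {x : V G}
          (U W : LineInMusic Ψ x n) →
          word (line U) ≢ word (line W) → ∀ z → (P^ U z × P^ W z) ⇔ (z ∈L U × z ∈L W)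
P^-meet {Ψ = Ψ} {x} U W U≢W z = mk⇔ P^⇒L L⇒P^
  where
  P^⇒L : P^ U z × P^ W z → z ∈L U × z ∈L W
  P^⇒L ((a , _ , ηa≡z) , (b , _ , ηb≡z))
    with η-meet {S = λ c → Ψ c x} (line U) (line W) (consts U) (consts W) U≢W
                (concat-injective _ _ (trans ηa≡z (sym ηb≡z)))
  ... | Ψax , Ψbx = (a , Ψax , ηa≡z) , (b , Ψbx , ηb≡z)

  L⇒P^ : z ∈L U × z ∈L W → P^ U z × P^ W z
  L⇒P^ ((a , Ψax , ηa≡z) , (b , Ψbx , ηb≡z)) =
    (a , (x , Ψax) , ηa≡z) , (b , (x , Ψbx) , ηb≡z)

fact4p4 : (k : ℕ) → 3 ≤ k → (G : Hypergraph k) →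
          (m : ℕ) (Ψ : Point k m → V G → Set) → IsPicture G Ψ →
          (x : V G) (n : ℕ) → 1 ≤ n →
          (𝓛 : LineInMusic Ψ x n → Set) →
          (∀ U → 𝓛 U →
             IsPicture G (Ψ^ U) × (∀ z → Ψ^ U z x ⇔ z ∈L U)) ×
          (∀ U W → 𝓛 U → 𝓛 W → word (line U) ≢ word (line W) →
             ∀ z → (P^ U z × P^ W z) ⇔ (z ∈L U × z ∈L W))
fact4p4 _ _ G _ _ Π-picture _ _ _ _ =
  (λ U _ → Ψ^-isPicture {G = G} U Π-picture , Ψ^-fibre {G = G} U) ,
  (λ U W _ _ → P^-meet {G = G} U W)
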